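{- Let $A$ be a finite alphabet, let $X=X_0\cdots X_{m-1}\in A^m$ ($m\ge 1$) be a pattern and $W=W_0\cdots W_{n-1}\in A^n$ a text. Run Algorithm FIND on $(X,W,B)$ where $B$ is the table of $\mathrm{mp}_X$ (resp. of $\mathrm{kmp}_X$). Then the sequence over $\{N,T\}$ of results of the evaluated comparisons $X[i]\neq W[j]$ (in execution order, writing $T$ when the comparison evaluates to true and $N$ when it evaluates to false) is equal to the output of the word $W$ in the transducer $\mathcal{T}^{\mathrm{mp}}_X$ (resp. $\mathcal{T}^{\mathrm{kmp}}_X$), i.e. the concatenation of the outputs of the transitions of the unique path labeled by $W$ starting from the initial state $\varepsilon$.
   Context: Indices of words start at $0$; $u[i]=u_i$; $\mathrm{pref}(u,i)$ is the prefix of length $i$ of $u$. A strict border of $u$ is a word that is both a strict prefix and a strict suffix of $u$. $\mathrm{mp}_X$ maps each prefix $u$ of $X$ to its longest strict border, with $\mathrm{mp}_X(\varepsilon)=\bot$. $\mathrm{kmp}_X$ is defined by $\mathrm{kmp}_X(X)=\mathrm{mp}_X(X)$, $\mathrm{kmp}_X(\varepsilon)=\bot$, and for every prefix $u\alpha$ of $X$ ($u\in A^*$, $\alpha\in A$), $\mathrm{kmp}_X(u)$ is the longest strict suffix of $u$ that is also a prefix of $u$ and such that $\mathrm{kmp}_X(u)\alpha$ is not a prefix of $X$, and $\bot$ if none exists. For $b\in\{\mathrm{mp}_X,\mathrm{kmp}_X\}$ the table $B$ is $B[i]=|b(\mathrm{pref}(X,i))|$ for $0\le i\le m$, with $|\bot|=-1$.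 Algorithm FIND$(X,W,B)$: set $m,n\gets|X|,|W|$; $i,j,nb\gets 0,0,0$; while $j<n$: { while ($i\ge 0$ and $X[i]\neq W[j]$): $i\gets B[i]$; then $i,j\gets i+1,j+1$; if $i=m$: { $i\gets B[i]$; $nb\gets nb+1$ } }; return $nb$. The "and" is short-circuit: $X[i]\neq W[j]$ is evaluated only when $i\ge 0$. $Q_X$ is the set of strict prefixes of $X$. The transducers $\mathcal{T}^{\mathrm{mp}}_X$, $\mathcal{T}^{\mathrm{kmp}}_X$ have state set $Q_X$, initial state $\varepsilon$, deterministic complete transition function $\delta_X(u,\alpha)=$ the longest suffix of $u\alpha$ belonging to $Q_X$, and output of the transition from $u$ reading $\alpha$ given by $\mathrm{out}(u,\alpha)=N$ if $u\alpha\in Q_X$ or $u\alpha=X$; $=T$ if $u\alpha\notin Q_X\cup\{X\}$ and $b(u)=\bot$; and $=T\cdot \mathrm{out}(b(u),\alpha)$ otherwise, where $b=\mathrm{mp}_X$ for $\mathcal{T}^{\mathrm{mp}}_X$ and $b=\mathrm{kmp}_X$ for $\mathcal{T}^{\mathrm{kmp}}_X$. -}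

module Defs where

open import Data.Nat using (ℕ; zero; suc; _<_; _≤_; _∸_; _⊓_; s≤s; z≤n)
open import Data.Nat.Properties using (≤-trans; ≤-refl; m⊓n≤m; n<1+n; ≤-reflexive)
open import Data.Fin using (Fin; toℕ; fromℕ; inject₁)
open import Data.Fin.Properties using (toℕ<n)
import Data.Fin as F
open import Data.List using (List; []; _∷_; _++_; take; drop; length; _∷ʳ_)
open import Data.List.Properties using (≡-dec; length-take)
open import Data.Maybe using (Maybe; just; nothing; maybe)
import Data.Maybe as M
open import Data.Integer using (ℤ; +_; -[1+_]) renaming (_+_ to _+ℤ_)
import Data.Integer as Z
open import Data.Product using (_×_; _,_)
open import Data.Sum using (_⊎_)
open import Data.Bool using (if_then_else_)
open import Relation.Nullary using (¬_; Dec; yes; no)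
open import Relation.Nullary.Decidable using (⌊_⌋; _×-dec_; _⊎-dec_; ¬?)
open import Relation.Unary using (Decidable)
open import Relation.Binary.PropositionalEquality using (_≡_)

data Cmp : Set where
  N T : Cmp

Word : ℕ → Set
Word k = List (Fin k)

_‼_ : ∀ {k} → Word k → ℕ → Maybe (Fin k)
[]       ‼ _     = nothing
(x ∷ xs) ‼ zero  = just x
(x ∷ xs) ‼ suc i = xs ‼ i

_≟w_ : ∀ {k} (u v : Word k) → Dec (u ≡ v)
_≟w_ = ≡-dec F._≟_

IsPrefix : ∀ {k} → Word k → Word k → Set
IsPrefix v u = take (length v) u ≡ v

IsSuffix : ∀ {k} → Word k → Word k → Set
IsSuffix v u = drop (length u ∸ length v) u ≡ v

StrictBorder : ∀ {k} → Word k → Word k → Set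
StrictBorder v u = (length v < length u) × IsPrefix v u × IsSuffix v u

strictBorder? : ∀ {k} (v u : Word k) → Dec (StrictBorder v u)
strictBorder? v u =
  (suc (length v) Data.Nat.≤? length u) ×-dec ((take (length v) u ≟w v) ×-dec (drop (length u ∸ length v) u ≟w v))

largest : (l : ℕ) (P : Fin l → Set) → Decidable P → Maybe (Fin l)
largest zero    P P? = nothing
largest (suc l) P P? with P? (fromℕ l)
... | yes _ = just (fromℕ l)
... | no  _ = M.map inject₁ (largest l (λ i → P (inject₁ i)) (λ i → P? (inject₁ i)))

-- mp(u): length of the longest strict border of u (nothing = ⊥).
-- A strict border of length l is necessarily take l u.
mp : ∀ {k} (u : Word k) → Maybe (Fin (length u))
mp u = largest (length u) (λ l → StrictBorder (take (toℕ l) u) u)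
                          (λ l → strictBorder? (take (toℕ l) u) u)

-- A border function for X: for the prefix u = pref(X,i), a length < |u| or ⊥
BorderFun : ∀ {k} → Word k → Set
BorderFun X = (i : ℕ) → Maybe (Fin (length (take i X)))

mpX : ∀ {k} (X : Word k) → BorderFun X
mpX X i = mp (take i X)

kmpX : ∀ {k} (X : Word k) → BorderFun X
kmpX X i with X ‼ i
... | nothing = mp (take i X)
... | just α  = largest (length u)
                  (λ l → StrictBorder (take (toℕ l) u) u × ¬ IsPrefix (take (toℕ l) u ∷ʳ α) X)
                  (λ l → strictBorder? (take (toℕ l) u) u
                           ×-dec ¬? ((take (length (take (toℕ l) u ∷ʳ α)) X) ≟w (take (toℕ l) u ∷ʳ α)))
  where u = take i X

data Kind : Set where
  MP KMP : Kind

border : ∀ {k} → Kind → (X : Word k) → BorderFun X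
border MP  = mpX
border KMP = kmpX

table : ∀ {k} (X : Word k) → BorderFun X → ℕ → ℤ
table X b i = maybe (λ l → + toℕ l) (-[1+ 0 ]) (b i)

-- Operational semantics of FIND (X,W,B), recording the results of the
-- evaluated comparisons X[i] ≠ W[j] (T = true, N = false).

-- inner loop  "while (i ≥ 0 and X[i] ≠ a) : i ← B[i]"  from i, ending in i'
data Inner {k} (X : Word k) (B : ℕ → ℤ) (a : Fin k) : ℤ → ℤ → List Cmp → Set where
  stop-neg : ∀ {n} → Inner X B a (-[1+ n ]) (-[1+ n ]) []
  stop-eq  : ∀ {i} → X ‼ i ≡ just a → Inner X B a (+ i) (+ i) (N ∷ [])
  step     : ∀ {i b i' t} → X ‼ i ≡ just b → ¬ (b ≡ a) →
             Inner X B a (B i) i' t → Inner X B a (+ i) i' (T ∷ t)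

-- after incrementing i: if i = m then i ← B[i]
reset : ∀ {k} (X : Word k) (B : ℕ → ℤ) → ℤ → ℤ
reset X B i = if ⌊ i Z.≟ + length X ⌋ then B (length X) else i

-- outer loop over the remaining text (the counter nb does not influence
-- the comparisons and is omitted)
data Outer {k} (X : Word k) (B : ℕ → ℤ) : ℤ → Word k → List Cmp → Set where
  done : ∀ {i} → Outer X B i [] []
  next : ∀ {i i' a W t t'} → Inner X B a i i' t →
         Outer X B (reset X B (i' +ℤ + 1)) W t' → Outer X B i (a ∷ W) (t ++ t')

FindTrace : ∀ {k} (X W : Word k) (B : ℕ → ℤ) → List Cmp → Set
FindTrace X W B t = Outer X B (+ 0) W t

-- The transducer.  A state (strict prefix u of X) is represented by its
-- length l, u = take l X.

InQorX : ∀ {k} → Word k → Word k → Set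
InQorX v X = (IsPrefix v X × length v < length X) ⊎ v ≡ X

inQorX? : ∀ {k} (v X : Word k) → Dec (InQorX v X)
inQorX? v X = ((take (length v) X ≟w v) ×-dec (suc (length v) Data.Nat.≤? length X)) ⊎-dec (v ≟w X)

-- δ_X(u,α): longest suffix of uα belonging to Q_X (always exists as ε ∈ Q_X
-- when |X| ≥ 1; the default 0 is never used then)
δ : ∀ {k} (X : Word k) → ℕ → Fin k → ℕ
δ X l α = maybe toℕ 0
  (largest (length X) (λ q → IsSuffix (take (toℕ q) X) (take l X ∷ʳ α))
                      (λ q → drop (length (take l X ∷ʳ α) ∸ length (take (toℕ q) X)) (take l X ∷ʳ α)
                               ≟w take (toℕ q) X))

private
  len-take≤ : ∀ {k} (l : ℕ) (X : Word k) → length (take l X) ≤ l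
  len-take≤ l X = ≤-trans (≤-reflexive (length-take l X)) (m⊓n≤m l (length X))

-- out(u,α), by recursion on |u| (b(u) is strictly shorter than u)
outGo : ∀ {k} (X : Word k) → BorderFun X → (f l : ℕ) → l < f → Fin k → List Cmp
outGo X b (suc f) l (s≤s l≤f) α with inQorX? (take l X ∷ʳ α) X
... | yes _ = N ∷ []
... | no  _ with b l
...   | nothing = T ∷ []
...   | just l' = T ∷ outGo X b f (toℕ l') (≤-trans (toℕ<n l') (≤-trans (len-take≤ l X) l≤f)) α

out : ∀ {k} (X : Word k) → BorderFun X → ℕ → Fin k → List Cmp
out X b l α = outGo X b (suc l) l (n<1+n l) α

run : ∀ {k} (X : Word k) → BorderFun X → ℕ → Word k → List Cmp
run X b l []      = []
run X b l (α ∷ W) = out X b l α ++ run X b (δ X l α) W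

transducerOutput : ∀ {k} (X : Word k) → BorderFun X → Word k → List Cmp
transducerOutput X b W = run X b 0 W

{-# OPTIONS --safe #-}

-- While FIND reads a letter a in the transducer state u = pref(X,l), its inner loop only visits
-- lengths q of suffixes of u that are prefixes of X, and it stops at the largest such q with
-- X[q] = a, or at -1 if there is none: a failure link b(q) only jumps over borders that X
-- continues with the letter X[q] ≠ a (by maximality for mp, by definition for kmp). So the
-- comparisons made are exactly out(u,a), and the next value of i is |δ(u,a)| = q + 1, or
-- B[m] = |mp(X)| when q + 1 = m, i.e. when ua = X. As FIND is deterministic, its trace is
-- the output of the transducer.

module Submission where

open import Defs
open import Data.Nat using (ℕ; _≤_)
open import Data.Fin using (Fin)
open import Data.List using (List; length)
open import Data.Product using (_×_)
open import Relation.Binary.PropositionalEquality using (_≡_)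

import Algebra.Properties.Monoid.Divisibility as Divisibility
open import Data.Empty using (⊥-elim)
open import Data.Fin using (toℕ; fromℕ; inject₁)
import Data.Fin as Fin
open import Data.Fin.Properties using (toℕ<n; toℕ-fromℕ; toℕ-inject₁)
open import Data.Integer as ℤ using (ℤ; +_; -[1+_])
open import Data.Integer.Properties using (+-injective)
open import Data.List using ([]; _∷_; _++_; take; drop; _∷ʳ_; [_])
open import Data.List.Properties
  using ( ++-monoid; ++-assoc; length-++; length-++-≤ʳ; length-take; take-take; take-all; take++drop≡id
        ; ∷ʳ-injective; ∷ʳ-injectiveʳ)
open import Data.Maybe using (Maybe; just; nothing; maybe)
import Data.Maybe as Maybe
open import Data.Maybe.Properties using (just-injective; map-∘; map-cong)
import Data.Maybe.Properties as Maybeₚ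
open import Data.Maybe.Relation.Unary.All as All using (All; just; nothing)
open import Data.Nat using (zero; suc; _<_; _+_; _∸_; z≤n; s≤s; s≤s⁻¹)
open import Data.Nat.Properties
  using ( ≤-refl; ≤-reflexive; ≤-antisym; <-trans; <-≤-trans; <⇒≤; <⇒≱; <⇒≢; ≤∧≢⇒<; n<1+n; n≮0; <-cmp
        ; m≤n⇒m<n∨m≡n; +-comm; m+n∸n≡m; m≤n⇒m⊓n≡m; ⊓-monoˡ-≤)
open import Data.Product using (∃; _,_; proj₁; proj₂)
open import Data.Sum using (inj₁; inj₂)
open import Data.Product.Function.NonDependent.Propositional using (_×-⇔_)
open import Data.Unit using (⊤; tt)
open import Function using (_∘_; _⇔_; mk⇔; Equivalence)
open import Function.Related.TypeIsomorphisms using (¬-cong-⇔)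
open import Relation.Binary using (tri<; tri≈; tri>)
open import Relation.Binary.PropositionalEquality
  using (_≢_; refl; sym; trans; cong; subst; subst₂; module ≡-Reasoning)
open import Relation.Nullary using (¬_; yes; no)
open import Relation.Nullary.Decidable using (decidable-stable)
open import Relation.Unary using (Decidable)

open Equivalence using (to; from)

-- Largest elements of predicates on ℕ

-- Maybe ℕ stands for ℕ ∪ {⊥}, with nothing = ⊥ below every natural number (FIND's index -1,
-- see toℤ).
_≺_ : Maybe ℕ → ℕ → Set
nothing ≺ _ = ⊤
just q  ≺ n = q < n

IsLargest : (ℕ → Set) → Maybe ℕ → Set
IsLargest P r = All P r × (∀ n → r ≺ n → ¬ P n)

IsLargest-unique : ∀ {P r r′} → IsLargest P r → IsLargest P r′ → r ≡ r′
IsLargest-unique (nothing , _)    (nothing , _)     = refl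
IsLargest-unique (nothing , none) (just p′ , _)     = ⊥-elim (none _ tt p′)
IsLargest-unique (just p , _)     (nothing , none′) = ⊥-elim (none′ _ tt p)
IsLargest-unique {r = just n} {just n′} (just p , above) (just p′ , above′) with <-cmp n n′
... | tri< n<n′ _ _ = ⊥-elim (above n′ n<n′ p′)
... | tri≈ _ n≡n′ _ = cong just n≡n′
... | tri> _ _ n′<n = ⊥-elim (above′ n n′<n p)

IsLargest-⇔ : ∀ {P Q r} → (∀ n → P n ⇔ Q n) → IsLargest P r → IsLargest Q r
IsLargest-⇔ P⇔Q (largest , none) = All.map (to (P⇔Q _)) largest , λ n above → none n above ∘ from (P⇔Q n)

largest-spec : ∀ L {P : Fin L → Set} (P? : Decidable P) {Q : ℕ → Set} →
  (∀ i → P i ⇔ Q (toℕ i)) → (∀ {n} → Q n → n < L) → IsLargest Q (Maybe.map toℕ (largest L P P?))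
largest-spec zero    P? P⇔Q bounded = nothing , λ n _ → n≮0 ∘ bounded
largest-spec (suc L) {P} P? {Q} P⇔Q bounded with P? (fromℕ L)
... | yes p = just (to (P⇔Q (fromℕ L)) p) ,
              λ n L<n q → <⇒≱ (subst (_< n) (toℕ-fromℕ L) L<n) (s≤s⁻¹ (bounded q))
... | no ¬p = subst (IsLargest Q) (map-toℕ-inject₁ (largest L (P ∘ inject₁) (P? ∘ inject₁)))
                (largest-spec L (P? ∘ inject₁) P∘inject₁⇔Q bounded′)
  where
  P∘inject₁⇔Q : ∀ i → P (inject₁ i) ⇔ Q (toℕ i)
  P∘inject₁⇔Q i = subst (λ j → P (inject₁ i) ⇔ Q j) (toℕ-inject₁ i) (P⇔Q (inject₁ i))
  ¬Q-L : ¬ Q L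
  ¬Q-L q = ¬p (from (P⇔Q (fromℕ L)) (subst Q (sym (toℕ-fromℕ L)) q))
  bounded′ : ∀ {n} → Q n → n < L
  bounded′ q = ≤∧≢⇒< (s≤s⁻¹ (bounded q)) (λ { refl → ¬Q-L q })
  map-toℕ-inject₁ : ∀ (r : Maybe (Fin L)) → Maybe.map toℕ r ≡ Maybe.map toℕ (Maybe.map inject₁ r)
  map-toℕ-inject₁ r = trans (sym (map-cong toℕ-inject₁ r)) (map-∘ r)

toℤ : Maybe ℕ → ℤ
toℤ = maybe +_ -[1+ 0 ]

largest-value : ∀ L {P : Fin L → Set} (P? : Decidable P) {Q : ℕ → Set} →
  (∀ i → P i ⇔ Q (toℕ i)) → (∀ {n} → Q n → n < L) → Q 0 →
  ∀ {r} → IsLargest Q r → toℤ r ≡ + maybe toℕ 0 (largest L P P?)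
largest-value L P? {Q} P⇔Q bounded Q0 largest-r =
  trans (cong toℤ (IsLargest-unique largest-r spec)) (default-unused (largest L _ P?) spec)
  where
  spec : IsLargest Q (Maybe.map toℕ (largest L _ P?))
  spec = largest-spec L P? P⇔Q bounded
  default-unused : ∀ (r : Maybe (Fin L)) → IsLargest Q (Maybe.map toℕ r) → toℤ (Maybe.map toℕ r) ≡ + maybe toℕ 0 r
  default-unused (just _) _          = refl
  default-unused nothing  (_ , none) = ⊥-elim (none 0 tt Q0)

largest-default-< : ∀ L {P : Fin L → Set} (P? : Decidable P) → 0 < L → maybe toℕ 0 (largest L P P?) < L
largest-default-< L P? 0<L with largest L _ P?
... | just i  = toℕ<n i
... | nothing = 0<L

-- In the free monoid (List A, _++_, []), v ∣ʳ u says that v is a suffix of u.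
module _ {a} {A : Set a} where
  open Divisibility (++-monoid A) using (_∣ʳ_; _,_)

  ∣ʳ⇒length≤ : ∀ {v u : List A} → v ∣ʳ u → length v ≤ length u
  ∣ʳ⇒length≤ {v} (p , refl) = length-++-≤ʳ v {p}

  ∣ʳ-shorter : ∀ {v w u : List A} → v ∣ʳ u → w ∣ʳ u → length v ≤ length w → v ∣ʳ w
  ∣ʳ-shorter (p , p++v≡u) (q , q++w≡u) = common-tail p q (trans p++v≡u (sym q++w≡u))
    where
    common-tail : ∀ p q {v w : List A} → p ++ v ≡ q ++ w → length v ≤ length w → v ∣ʳ w
    common-tail p       []      eq   _ = p , eq
    common-tail []      (y ∷ q) refl |v|≤|w| = ⊥-elim (<⇒≱ (s≤s (length-++-≤ʳ _ {q})) |v|≤|w|)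
    common-tail (x ∷ p) (y ∷ q) eq   |v|≤|w| = common-tail p q (cong (drop 1) eq) |v|≤|w|

  ∷ʳ-∣ʳ⁻ : ∀ {v u : List A} {x y} → v ∷ʳ x ∣ʳ u ∷ʳ y → v ∣ʳ u × x ≡ y
  ∷ʳ-∣ʳ⁻ {v} {u} {x} (p , eq) with ∷ʳ-injective (p ++ v) u (trans (++-assoc p v [ x ]) eq)
  ... | p++v≡u , x≡y = (p , p++v≡u) , x≡y

  drop-length-++ : ∀ (p v : List A) → drop (length p) (p ++ v) ≡ v
  drop-length-++ []      v = refl
  drop-length-++ (x ∷ p) v = drop-length-++ p v

  length-take-≤ : ∀ {n} {xs : List A} → n ≤ length xs → length (take n xs) ≡ n
  length-take-≤ {n} {xs} n≤|xs| = trans (length-take n xs) (m≤n⇒m⊓n≡m n≤|xs|)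

  take-take-≤ : ∀ {n i} {xs : List A} → n ≤ i → take n (take i xs) ≡ take n xs
  take-take-≤ {n} {i} {xs} n≤i = trans (take-take n i xs) (cong (λ j → take j xs) (m≤n⇒m⊓n≡m n≤i))

  length-take-∷ʳ : ∀ {n x} {xs : List A} → n ≤ length xs → length (take n xs ∷ʳ x) ≡ suc n
  length-take-∷ʳ {n} {x} {xs} n≤|xs| =
    trans (length-++ (take n xs)) (trans (+-comm _ 1) (cong suc (length-take-≤ n≤|xs|)))

  take-∣ʳ-take : ∀ {n q} {xs u : List A} → take n xs ∣ʳ u → take q xs ∣ʳ u → n ≤ q → take n xs ∣ʳ take q xs
  take-∣ʳ-take {n} {q} {xs} n∣u q∣u n≤q = ∣ʳ-shorter n∣u q∣u
    (subst₂ _≤_ (sym (length-take n xs)) (sym (length-take q xs)) (⊓-monoˡ-≤ (length xs) n≤q))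

module _ {k : ℕ} where
  open Divisibility (++-monoid (Fin k)) using (_∣ʳ_; _,_)

  IsSuffix⇒∣ʳ : ∀ {v u : Word k} → IsSuffix v u → v ∣ʳ u
  IsSuffix⇒∣ʳ {v} {u} drop≡v = subst (_∣ʳ u) drop≡v (take n u , take++drop≡id n u)
    where
    n : ℕ
    n = length u ∸ length v

  ∣ʳ⇒IsSuffix : ∀ {v u : Word k} → v ∣ʳ u → IsSuffix v u
  ∣ʳ⇒IsSuffix {v} (p , refl) = begin
    drop (length (p ++ v) ∸ length v) (p ++ v)     ≡⟨ cong (λ j → drop (j ∸ length v) (p ++ v)) (length-++ p) ⟩
    drop (length p + length v ∸ length v) (p ++ v) ≡⟨ cong (λ j → drop j (p ++ v)) (m+n∸n≡m (length p) (length v)) ⟩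
    drop (length p) (p ++ v)                       ≡⟨ drop-length-++ p v ⟩
    v                                              ∎
    where open ≡-Reasoning

module _ {k : ℕ} where
  ‼-defined : ∀ {n} {xs : Word k} → n < length xs → ∃ λ x → xs ‼ n ≡ just x
  ‼-defined {zero}  {x ∷ xs} _         = x , refl
  ‼-defined {suc n} {x ∷ xs} (s≤s n<) = ‼-defined {xs = xs} n<

  ‼-just⇒< : ∀ {n x} {xs : Word k} → xs ‼ n ≡ just x → n < length xs
  ‼-just⇒< {zero}  {xs = _ ∷ _}  _  = s≤s z≤n
  ‼-just⇒< {suc n} {xs = _ ∷ xs} eq = s≤s (‼-just⇒< {n} {xs = xs} eq)

  ‼-length : ∀ (xs : Word k) → xs ‼ length xs ≡ nothing
  ‼-length []       = refl
  ‼-length (x ∷ xs) = ‼-length xs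

  ∷ʳ-‼-length : ∀ (u : Word k) x → (u ∷ʳ x) ‼ length u ≡ just x
  ∷ʳ-‼-length []      x = refl
  ∷ʳ-‼-length (y ∷ u) x = ∷ʳ-‼-length u x

  take-suc-‼ : ∀ {n x} (xs : Word k) → xs ‼ n ≡ just x → take (suc n) xs ≡ take n xs ∷ʳ x
  take-suc-‼ {zero}  (y ∷ xs) refl = refl
  take-suc-‼ {suc n} (y ∷ xs) eq   = cong (y ∷_) (take-suc-‼ xs eq)

-- Borders of the prefixes of a pattern

module Pattern {k : ℕ} (X : Word k) where
  open Divisibility (++-monoid (Fin k)) using (_∣ʳ_; _,_; ∣ʳ-refl; ∣ʳ-trans; ε∣ʳ_; x∣ʳy⇒xz∣ʳyz)

  m : ℕ
  m = length X

  IsBorder : ℕ → ℕ → Set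
  IsBorder q n = n < q × take n X ∣ʳ take q X

  private
    toℕ<i : ∀ {i} → i ≤ m → (j : Fin (length (take i X))) → toℕ j < i
    toℕ<i i≤m j = subst (toℕ j <_) (length-take-≤ i≤m) (toℕ<n j)

    IsBorder⇒<length : ∀ {i n} → i ≤ m → IsBorder i n → n < length (take i X)
    IsBorder⇒<length i≤m (n<i , _) = subst (_ <_) (sym (length-take-≤ i≤m)) n<i

  StrictBorder⇔IsBorder : ∀ {i n} → i ≤ m → n < i → StrictBorder (take n (take i X)) (take i X) ⇔ IsBorder i n
  StrictBorder⇔IsBorder {i} {n} i≤m n<i = mk⇔
    (λ (_ , _ , suffix) → n<i , subst (_∣ʳ u) take-n-u≡take-n-X (IsSuffix⇒∣ʳ suffix))
    (λ (_ , n∣i) →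
       subst₂ _<_ (sym |take-n-u|≡n) (sym |u|≡i) n<i ,
       cong (λ j → take j u) |take-n-u|≡n ,
       ∣ʳ⇒IsSuffix (subst (_∣ʳ u) (sym take-n-u≡take-n-X) n∣i))
    where
    u : Word k
    u = take i X
    |u|≡i : length u ≡ i
    |u|≡i = length-take-≤ i≤m
    |take-n-u|≡n : length (take n u) ≡ n
    |take-n-u|≡n = length-take-≤ (subst (n ≤_) (sym |u|≡i) (<⇒≤ n<i))
    take-n-u≡take-n-X : take n u ≡ take n X
    take-n-u≡take-n-X = take-take-≤ (<⇒≤ n<i)

  IsPrefix⇔‼ : ∀ {n c} → n < m → IsPrefix (take n X ∷ʳ c) X ⇔ X ‼ n ≡ just c
  IsPrefix⇔‼ {n} {c} n<m = mk⇔ prefix⇒‼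
    (λ X[n]≡c → subst (λ j → take j X ≡ take n X ∷ʳ c) (sym |take-n-X∷ʳc|) (take-suc-‼ X X[n]≡c))
    where
    |take-n-X∷ʳc| : length (take n X ∷ʳ c) ≡ suc n
    |take-n-X∷ʳc| = length-take-∷ʳ (<⇒≤ n<m)
    prefix⇒‼ : IsPrefix (take n X ∷ʳ c) X → X ‼ n ≡ just c
    prefix⇒‼ prefix with ‼-defined {xs = X} n<m
    ... | x , X[n]≡x = subst (λ y → X ‼ n ≡ just y) x≡c X[n]≡x
      where
      x≡c : x ≡ c
      x≡c = ∷ʳ-injectiveʳ (take n X) (take n X)
              (trans (sym (take-suc-‼ X X[n]≡x)) (subst (λ j → take j X ≡ take n X ∷ʳ c) |take-n-X∷ʳc| prefix))

  InQorX⇔‼ : ∀ {q a} → q < m → InQorX (take q X ∷ʳ a) X ⇔ X ‼ q ≡ just a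
  InQorX⇔‼ {q} {a} q<m = mk⇔
    (λ { (inj₁ (prefix , _)) → to (IsPrefix⇔‼ q<m) prefix
       ; (inj₂ eq) → trans (cong (_‼ q) (sym eq))
                       (subst (λ j → (take q X ∷ʳ a) ‼ j ≡ just a) (length-take-≤ (<⇒≤ q<m)) (∷ʳ-‼-length (take q X) a)) })
    ‼⇒InQorX
    where
    ‼⇒InQorX : X ‼ q ≡ just a → InQorX (take q X ∷ʳ a) X
    ‼⇒InQorX X[q]≡a with m≤n⇒m<n∨m≡n q<m
    ... | inj₁ 1+q<m = inj₁ (from (IsPrefix⇔‼ q<m) X[q]≡a , subst (_< m) (sym (length-take-∷ʳ (<⇒≤ q<m))) 1+q<m)
    ... | inj₂ 1+q≡m = inj₂ (trans (sym (take-suc-‼ X X[q]≡a)) (take-all (suc q) X (≤-reflexive (sym 1+q≡m))))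

  mp-largest : ∀ {i} → i ≤ m → IsLargest (IsBorder i) (Maybe.map toℕ (mpX X i))
  mp-largest {i} i≤m = largest-spec (length (take i X)) _
    (λ j → StrictBorder⇔IsBorder i≤m (toℕ<i i≤m j)) (IsBorder⇒<length i≤m)

  kmp-largest : ∀ {i c} → X ‼ i ≡ just c →
    IsLargest (λ n → IsBorder i n × X ‼ n ≢ just c) (Maybe.map toℕ (kmpX X i))
  kmp-largest {i} {c} X[i]≡c with X ‼ i | X[i]≡c | ‼-just⇒< {xs = X} X[i]≡c
  ... | just .c | refl | i<m = largest-spec (length (take i X)) _
    (λ j → StrictBorder⇔IsBorder i≤m (toℕ<i i≤m j) ×-⇔ ¬-cong-⇔ (extends⇔ j)) (IsBorder⇒<length i≤m ∘ proj₁)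
    where
    i≤m : i ≤ m
    i≤m = <⇒≤ i<m
    extends⇔ : ∀ j → IsPrefix (take (toℕ j) (take i X) ∷ʳ c) X ⇔ X ‼ toℕ j ≡ just c
    extends⇔ j = subst (λ v → IsPrefix (v ∷ʳ c) X ⇔ X ‼ toℕ j ≡ just c)
      (sym (take-take-≤ (<⇒≤ (toℕ<i i≤m j)))) (IsPrefix⇔‼ (<-≤-trans (toℕ<i i≤m j) i≤m))

  kmp-at-end : kmpX X m ≡ mpX X m
  kmp-at-end with X ‼ m | ‼-length X
  ... | nothing | refl = refl

  -- A failure link r at the prefix of length q, where X continues with c, may only jump over
  -- borders that X also continues with c: at those, FIND's comparison would fail again.
  Skips : ℕ → Fin k → Maybe ℕ → Set
  Skips q c r = All (IsBorder q) r × (∀ n → IsBorder q n → r ≺ n → X ‼ n ≡ just c)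

  largest⇒Skips : ∀ {q c r} → IsLargest (IsBorder q) r → Skips q c r
  largest⇒Skips (border , none) = border , λ n bn above → ⊥-elim (none n above bn)

  largest-mismatch⇒Skips : ∀ {q c r} → IsLargest (λ n → IsBorder q n × X ‼ n ≢ just c) r → Skips q c r
  largest-mismatch⇒Skips {c = c} (border , none) =
    All.map proj₁ border ,
    λ n bn above → decidable-stable (Maybeₚ.≡-dec Fin._≟_ (X ‼ n) (just c)) (λ X[n]≢c → none n above (bn , X[n]≢c))

  border-Skips : ∀ κ {q c} → X ‼ q ≡ just c → Skips q c (Maybe.map toℕ (border κ X q))
  border-Skips MP  X[q]≡c = largest⇒Skips (mp-largest (<⇒≤ (‼-just⇒< {xs = X} X[q]≡c)))
  border-Skips KMP X[q]≡c = largest-mismatch⇒Skips (kmp-largest X[q]≡c)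

  border-at-end : ∀ κ → IsLargest (IsBorder m) (Maybe.map toℕ (border κ X m))
  border-at-end MP  = mp-largest ≤-refl
  border-at-end KMP = subst (IsLargest (IsBorder m) ∘ Maybe.map toℕ) (sym kmp-at-end) (mp-largest ≤-refl)

  table≡toℤ : ∀ (b : BorderFun X) q → table X b q ≡ toℤ (Maybe.map toℕ (b q))
  table≡toℤ b q with b q
  ... | just _  = refl
  ... | nothing = refl

  reset-≢ : ∀ B {n} → n ≢ m → reset X B (+ n) ≡ + n
  reset-≢ B {n} n≢m with + n ℤ.≟ + m
  ... | yes eq = ⊥-elim (n≢m (+-injective eq))
  ... | no  _  = refl

  reset-m : ∀ B → reset X B (+ m) ≡ B m
  reset-m B with + m ℤ.≟ + m
  ... | yes _   = refl
  ... | no  m≢m = ⊥-elim (m≢m refl)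

  module Simulation (1≤m : 1 ≤ m) (b : BorderFun X)
    (skips : ∀ {q c} → X ‼ q ≡ just c → Skips q c (Maybe.map toℕ (b q)))
    (at-end : IsLargest (IsBorder m) (Maybe.map toℕ (b m))) where

    B : ℕ → ℤ
    B = table X b

    module Letter {l : ℕ} (l<m : l < m) (a : Fin k) where
      Candidate : ℕ → Set
      Candidate n = take n X ∣ʳ take l X × X ‼ n ≡ just a

      SuffixState : ℕ → Set
      SuffixState n = n < m × take n X ∣ʳ take l X ∷ʳ a

      Candidate⇒≤ : ∀ {n} → Candidate n → n ≤ l
      Candidate⇒≤ (n∣l , X[n]≡a) = subst₂ _≤_
        (length-take-≤ (<⇒≤ (‼-just⇒< {xs = X} X[n]≡a))) (length-take-≤ (<⇒≤ l<m)) (∣ʳ⇒length≤ n∣l)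

      skipped-not-Candidate : ∀ {q c r} → take q X ∣ʳ take l X → X ‼ q ≡ just c → c ≢ a → Skips q c r →
        (∀ n → q < n → ¬ Candidate n) → ∀ n → r ≺ n → ¬ Candidate n
      skipped-not-Candidate {q} q∣l X[q]≡c c≢a (_ , skipped) above n r≺n (n∣l , X[n]≡a) with <-cmp n q
      ... | tri< n<q _ _ =
        c≢a (just-injective (trans (sym (skipped n (n<q , take-∣ʳ-take n∣l q∣l (<⇒≤ n<q)) r≺n)) X[n]≡a))
      ... | tri≈ _ refl _ = c≢a (just-injective (trans (sym X[q]≡c) X[n]≡a))
      ... | tri> _ _ q<n = above n q<n (n∣l , X[n]≡a)

      skips-at : ∀ {q c r} → X ‼ q ≡ just c → b q ≡ r → Skips q c (Maybe.map toℕ r)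
      skips-at X[q]≡c b[q]≡r = subst (Skips _ _ ∘ Maybe.map toℕ) b[q]≡r (skips X[q]≡c)

      mismatch-≢ : ∀ {q c} → q < m → X ‼ q ≡ just c → ¬ InQorX (take q X ∷ʳ a) X → c ≢ a
      mismatch-≢ q<m X[q]≡c ¬inQ refl = ¬inQ (from (InQorX⇔‼ q<m) X[q]≡c)

      mismatch-step : ∀ {q c r i t} → X ‼ q ≡ just c → c ≢ a → b q ≡ r →
        Inner X B a (toℤ (Maybe.map toℕ r)) i t → Inner X B a (+ q) i (T ∷ t)
      mismatch-step {q} X[q]≡c c≢a b[q]≡r = step X[q]≡c c≢a ∘
        subst (λ j → Inner X B a j _ _) (sym (trans (table≡toℤ b q) (cong (toℤ ∘ Maybe.map toℕ) b[q]≡r)))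

      inner-loop : ∀ f q (q<f : q < f) → q < m → take q X ∣ʳ take l X → (∀ n → q < n → ¬ Candidate n) →
        ∃ λ r → IsLargest Candidate r × Inner X B a (+ q) (toℤ r) (outGo X b f q q<f a)
      inner-loop (suc f) q (s≤s q≤f) q<m q∣l above with inQorX? (take q X ∷ʳ a) X
      ... | yes inQ = just q , (just (q∣l , X[q]≡a) , above) , stop-eq X[q]≡a
        where
        X[q]≡a : X ‼ q ≡ just a
        X[q]≡a = to (InQorX⇔‼ q<m) inQ
      ... | no ¬inQ with ‼-defined {xs = X} q<m | b q in eq
      ...   | c , X[q]≡c | nothing =
        nothing , (nothing , skipped-not-Candidate q∣l X[q]≡c c≢a (skips-at X[q]≡c eq) above) ,
        mismatch-step X[q]≡c c≢a eq stop-neg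
        where
        c≢a : c ≢ a
        c≢a = mismatch-≢ q<m X[q]≡c ¬inQ
      ...   | c , X[q]≡c | just l′ with skips-at X[q]≡c eq
      ...     | skips-l′@(just (l′<q , l′∣q) , _) =
        let r , largest-r , inner = inner-loop f (toℕ l′) _ (<-trans l′<q q<m) (∣ʳ-trans l′∣q q∣l)
                                      (skipped-not-Candidate q∣l X[q]≡c c≢a skips-l′ above)
        in r , largest-r , mismatch-step X[q]≡c c≢a eq inner
        where
        c≢a : c ≢ a
        c≢a = mismatch-≢ q<m X[q]≡c ¬inQ

      ∣ʳ-∷ʳ⇔Candidate : ∀ {q} → q < m → take (suc q) X ∣ʳ take l X ∷ʳ a ⇔ Candidate q
      ∣ʳ-∷ʳ⇔Candidate {q} q<m = mk⇔ extended⇒Candidate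
        (λ (q∣l , X[q]≡a) → subst (_∣ʳ _) (sym (take-suc-‼ X X[q]≡a)) (x∣ʳy⇒xz∣ʳyz [ a ] q∣l))
        where
        extended⇒Candidate : take (suc q) X ∣ʳ take l X ∷ʳ a → Candidate q
        extended⇒Candidate extended with ‼-defined {xs = X} q<m
        ... | x , X[q]≡x with ∷ʳ-∣ʳ⁻ (subst (_∣ʳ _) (take-suc-‼ X X[q]≡x) extended)
        ...   | q∣l , refl = q∣l , X[q]≡x

      no-SuffixState-above : ∀ {r} → (∀ n → r ≺ n → ¬ Candidate n) → ∀ n → maybe suc 0 r < n → ¬ SuffixState n
      no-SuffixState-above {nothing} none (suc n) _         (1+n<m , extended) =
        none n tt (to (∣ʳ-∷ʳ⇔Candidate (<⇒≤ 1+n<m)) extended)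
      no-SuffixState-above {just q}  none (suc n) (s≤s q<n) (1+n<m , extended) =
        none n q<n (to (∣ʳ-∷ʳ⇔Candidate (<⇒≤ 1+n<m)) extended)

      SuffixState⇔IsBorder : take m X ≡ take l X ∷ʳ a → ∀ n → IsBorder m n ⇔ SuffixState n
      SuffixState⇔IsBorder X≡l∷ʳa n = mk⇔
        (λ (n<m , n∣m) → n<m , subst (_ ∣ʳ_) X≡l∷ʳa n∣m)
        (λ (n<m , n∣l∷ʳa) → n<m , subst (_ ∣ʳ_) (sym X≡l∷ʳa) n∣l∷ʳa)

      Candidate-completes : ∀ {q} → Candidate q → suc q ≡ m → take m X ≡ take l X ∷ʳ a
      Candidate-completes {q} cand@(_ , X[q]≡a) 1+q≡m = begin
        take m X       ≡⟨ cong (λ j → take j X) (sym 1+q≡m) ⟩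
        take (suc q) X ≡⟨ take-suc-‼ X X[q]≡a ⟩
        take q X ∷ʳ a  ≡⟨ cong (λ j → take j X ∷ʳ a) q≡l ⟩
        take l X ∷ʳ a  ∎
        where
        open ≡-Reasoning
        q≡l : q ≡ l
        q≡l = ≤-antisym (Candidate⇒≤ cand) (s≤s⁻¹ (subst (suc l ≤_) (sym 1+q≡m) l<m))

      δ<m : δ X l a < m
      δ<m = largest-default-< m _ 1≤m

      largest-SuffixState≡δ : ∀ {r} → IsLargest SuffixState r → toℤ r ≡ + δ X l a
      largest-SuffixState≡δ = largest-value m _
        (λ j → mk⇔ (λ suffix → toℕ<n j , IsSuffix⇒∣ʳ suffix) (∣ʳ⇒IsSuffix ∘ proj₂)) proj₁ (1≤m , ε∣ʳ _)

      -- The next state is one more than the last candidate, except when that completes an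
      -- occurrence of X, which FIND handles with its extra jump to B[m].
      reset-after-inner-loop : ∀ {r} → IsLargest Candidate r → reset X B (toℤ r ℤ.+ + 1) ≡ + δ X l a
      reset-after-inner-loop {nothing} (_ , none) =
        trans (reset-≢ B (λ 0≡m → <⇒≱ 1≤m (≤-reflexive (sym 0≡m))))
              (largest-SuffixState≡δ (just (1≤m , ε∣ʳ _) , no-SuffixState-above none))
      reset-after-inner-loop {just q} (just cand , none) rewrite +-comm q 1
        with m≤n⇒m<n∨m≡n (‼-just⇒< {xs = X} (proj₂ cand))
      ... | inj₁ 1+q<m = trans (reset-≢ B (<⇒≢ 1+q<m))
              (largest-SuffixState≡δ (just (1+q<m , from (∣ʳ-∷ʳ⇔Candidate (<⇒≤ 1+q<m)) cand) , no-SuffixState-above none))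
      ... | inj₂ 1+q≡m = begin
        reset X B (+ suc q)           ≡⟨ cong (reset X B ∘ +_) 1+q≡m ⟩
        reset X B (+ m)               ≡⟨ reset-m B ⟩
        B m                           ≡⟨ table≡toℤ b m ⟩
        toℤ (Maybe.map toℕ (b m))    ≡⟨ largest-SuffixState≡δ (IsLargest-⇔ (SuffixState⇔IsBorder ua≡X) at-end) ⟩
        + δ X l a                     ∎
        where
        open ≡-Reasoning
        ua≡X : take m X ≡ take l X ∷ʳ a
        ua≡X = Candidate-completes cand 1+q≡m

      read-letter : ∀ {W t} → Outer X B (+ δ X l a) W t → Outer X B (+ l) (a ∷ W) (out X b l a ++ t)
      read-letter rest =
        let r , largest-r , inner = inner-loop (suc l) l (n<1+n l) l<m ∣ʳ-refl (λ n l<n → <⇒≱ l<n ∘ Candidate⇒≤)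
        in next inner (subst (λ i → Outer X B i _ _) (sym (reset-after-inner-loop largest-r)) rest)

    simulate : ∀ {l} → l < m → ∀ W → Outer X B (+ l) W (run X b l W)
    simulate l<m []      = done
    simulate l<m (a ∷ W) = Letter.read-letter l<m a (simulate (Letter.δ<m l<m a) W)

-- Determinism of FIND

module _ {k} {X : Word k} {B : ℕ → ℤ} where
  Inner-deterministic : ∀ {a i i₁ i₂ t₁ t₂} → Inner X B a i i₁ t₁ → Inner X B a i i₂ t₂ → i₁ ≡ i₂ × t₁ ≡ t₂
  Inner-deterministic stop-neg         stop-neg            = refl , refl
  Inner-deterministic (stop-eq _)      (stop-eq _)         = refl , refl
  Inner-deterministic (stop-eq X[i]≡a) (step X[i]≡c c≢a _) = ⊥-elim (c≢a (just-injective (trans (sym X[i]≡c) X[i]≡a)))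
  Inner-deterministic (step X[i]≡c c≢a _) (stop-eq X[i]≡a) = ⊥-elim (c≢a (just-injective (trans (sym X[i]≡c) X[i]≡a)))
  Inner-deterministic (step _ _ rest₁) (step _ _ rest₂) =
    let i₁≡i₂ , t₁≡t₂ = Inner-deterministic rest₁ rest₂ in i₁≡i₂ , cong (T ∷_) t₁≡t₂

  Outer-deterministic : ∀ {i W t₁ t₂} → Outer X B i W t₁ → Outer X B i W t₂ → t₁ ≡ t₂
  Outer-deterministic done done = refl
  Outer-deterministic (next inner₁ rest₁) (next inner₂ rest₂) with Inner-deterministic inner₁ inner₂
  ... | refl , refl = cong (_ ++_) (Outer-deterministic rest₁ rest₂)

lemma1 : ∀ {k : ℕ} (κ : Kind) (X W : List (Fin k)) → 1 ≤ length X →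
    FindTrace X W (table X (border κ X)) (transducerOutput X (border κ X) W)
    × (∀ t → FindTrace X W (table X (border κ X)) t → t ≡ transducerOutput X (border κ X) W)
lemma1 κ X W 1≤m = trace , λ t find-t → Outer-deterministic find-t trace
  where
  open Pattern X
  trace : FindTrace X W (table X (border κ X)) (transducerOutput X (border κ X) W)
  trace = Simulation.simulate 1≤m (border κ X) (border-Skips κ) (border-at-end κ) 1≤m W
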